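{- Let $b\ge2$ and let $P,Q$ be positive coprime integers that are both coprime to $b$. Let $D$ be the directed graph with vertex set $\{(i,j): 0\le i\le P-1,\ 0\le j\le Q-1\}$ and with an edge \[ (i,j)\to\left(\left\lfloor \frac{i+rP}{b}\right\rfloor,\left\lfloor \frac{j+rQ}{b}\right\rfloor\right) \] for every vertex $(i,j)$ and every $r\in\{0,1,\ldots,b-1\}$. Let $\mathcal{C}$ be the strongly connected component of $D$ containing $(0,0)$. Then $\mathcal{C}$ has exactly $P+Q-1$ elements and \[ \mathcal{C}=\left\{\bigl(\lfloor tP\rfloor,\lfloor tQ\rfloor\bigr): 0\le t<1\right\}. \] In particular, if $(i,j)\in\mathcal{C}$ and $(i,j)\ne(P-1,Q-1)$, then $(i+1,j)\in\mathcal{C}$ or $(i,j+1)\in\mathcal{C}$. -}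

module Defs where

open import Data.Nat using (ℕ; zero; suc; _+_; _*_; _<_; NonZero)
open import Data.Nat.DivMod using (_/_)
open import Data.Product using (_×_; _,_; ∃; ∃-syntax)
open import Relation.Binary.PropositionalEquality using (_≡_)
open import Relation.Binary.Construct.Closure.ReflexiveTransitive using (Star)
open import Data.List using (List; length)
open import Data.List.Membership.Propositional using (_∈_)
open import Data.List.Relation.Unary.Unique.Propositional using (Unique)

Vertex : Set
Vertex = ℕ × ℕ

InV : (P Q : ℕ) → Vertex → Set
InV P Q (i , j) = i < P × j < Q

Edge : (b P Q : ℕ) → .{{_ : NonZero b}} → Vertex → Vertex → Set
Edge b P Q (i , j) (k , l) =
  InV P Q (i , j) × ∃[ r ] (r < b × k ≡ (i + r * P) / b × l ≡ (j + r * Q) / b)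

Reach : (b P Q : ℕ) → .{{_ : NonZero b}} → Vertex → Vertex → Set
Reach b P Q = Star (Edge b P Q)

InC : (b P Q : ℕ) → .{{_ : NonZero b}} → Vertex → Set
InC b P Q v = InV P Q v × Reach b P Q (0 , 0) v × Reach b P Q v (0 , 0)

-- (i,j) = (⌊tP⌋, ⌊tQ⌋) for some 0 ≤ t < 1; t is written m/(suc k) with m < suc k
-- (rational t suffice: each nonempty fibre of t ↦ (⌊tP⌋,⌊tQ⌋) on [0,1) is a
--  half-open interval with nonempty interior, hence contains a rational)
FloorPt : (P Q : ℕ) → Vertex → Set
FloorPt P Q (i , j) =
  ∃[ k ] ∃[ m ] (m < suc k × i ≡ (m * P) / suc k × j ≡ (m * Q) / suc k)

HasCard : (Vertex → Set) → ℕ → Set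
HasCard S n =
  ∃[ xs ] (Unique xs × length xs ≡ n × (∀ v → (v ∈ xs → S v) × (S v → v ∈ xs)))

-- A vertex (i, j) lies in C exactly when the intervals [i/P, (i+1)/P) and [j/Q, (j+1)/Q)
-- overlap, i.e. when (i, j) = (⌊tP⌋, ⌊tQ⌋) for some t ∈ [0, 1).  The edge labelled r sends the
-- cell of t to the cell of (t + r)/b, so this property is invariant along edges; conversely,
-- from (0, 0) one reaches the cell of every t = N/bⁿ by reading the base-b digits of N from
-- the least significant one, every overlapping cell contains such a t, and the label 0 leads
-- from every vertex back to (0, 0).  The overlapping cells form a staircase: from each one
-- the next is (i+1, j) or (i, j+1) according as (i+1)/P < (j+1)/Q or not, coprimality of P
-- and Q excludes a tie before the corner (P-1, Q-1), and each antidiagonal i + j = s with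
-- s ≤ P + Q - 2 carries exactly one cell.

module Submission where

open import Function using (_∘_)
open import Data.Empty using (⊥-elim)
open import Data.Product using (_×_; _,_; proj₁; proj₂; swap; ∃-syntax)
open import Data.Sum using (_⊎_; inj₁; inj₂)
open import Data.Nat using (ℕ; zero; suc; _+_; _*_; _∸_; _^_; _⊔_; _≤_; _<_; pred; z≤n; s≤s;
                            NonZero; >-nonZero; >-nonZero⁻¹; _<?_)
open import Data.Nat.Properties
open import Data.Nat.DivMod
open import Data.Nat.Divisibility using (_∣_; divides; divides-refl; ∣⇒≤)
open import Data.Nat.Coprimality using (Coprime; coprime-divisor)
open import Data.Nat.Tactic.RingSolver using (solve-∀)
open import Algebra.Properties.CommutativeSemigroup *-commutativeSemigroup using (xy∙z≈xz∙y)
open import Data.List using (List; applyUpTo)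
open import Data.List.Properties using (length-applyUpTo)
open import Data.List.Membership.Propositional using (_∈_)
open import Data.List.Membership.Propositional.Properties using (∈-applyUpTo⁺; ∈-applyUpTo⁻)
open import Data.List.Relation.Unary.Unique.Propositional using (Unique)
open import Data.List.Relation.Unary.Unique.Propositional.Properties using (applyUpTo⁺₁)
open import Relation.Nullary using (¬_; yes; no)
open import Relation.Binary.Definitions using (tri<; tri≈; tri>)
open import Relation.Binary.PropositionalEquality
  using (_≡_; _≢_; refl; sym; trans; cong; cong₂; subst; subst₂; module ≡-Reasoning)
open import Relation.Binary.Construct.Closure.ReflexiveTransitive using (ε; _◅_; _◅◅_)

open import Defs

i*n≤m<[1+i]*n⇒m/n≡i : ∀ {m n i} .{{_ : NonZero n}} → i * n ≤ m → m < suc i * n → m / n ≡ i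
i*n≤m<[1+i]*n⇒m/n≡i {m} {n} {i} lo hi = ≤-antisym
  (≤-pred (m<n*o⇒m/o<n {n = suc i} hi))
  (subst (_≤ m / n) (m*n/n≡m i n) (/-monoˡ-≤ n lo))

m<[1+m/n]*n : ∀ m n .{{_ : NonZero n}} → m < suc (m / n) * n
m<[1+m/n]*n m n = begin-strict
  m                   ≡⟨ m≡m%n+[m/n]*n m n ⟩
  m % n + (m / n) * n <⟨ +-monoˡ-< ((m / n) * n) (m%n<n m n) ⟩
  suc (m / n) * n     ∎
  where open ≤-Reasoning

[m/n+o]/p≡[m+o*n]/[p*n] : ∀ m n o p .{{_ : NonZero n}} .{{_ : NonZero p}} .{{_ : NonZero (p * n)}} →
                          (m / n + o) / p ≡ (m + o * n) / (p * n)
[m/n+o]/p≡[m+o*n]/[p*n] m n o p = begin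
  (m / n + o) / p             ≡⟨ cong (λ x → (m / n + x) / p) (m*n/n≡m o n) ⟨
  (m / n + o * n / n) / p     ≡⟨ /-congˡ {o = p} (+-distrib-/-∣ʳ m (divides-refl o)) ⟨
  (m + o * n) / n / p         ≡⟨ m/n/o≡m/[n*o] (m + o * n) n p ⟩
  (m + o * n) / (n * p)       ≡⟨ /-congʳ (*-comm n p) ⟩
  (m + o * n) / (p * n)       ∎
  where
  open ≡-Reasoning
  instance
    n*p≢0 : NonZero (n * p)
    n*p≢0 = m*n≢0 n p

n<m^n : ∀ m n → 1 < m → n < m ^ n
n<m^n m zero    1<m = s≤s z≤n
n<m^n m (suc n) 1<m = begin-strict
  suc n     ≤⟨ n<m^n m n 1<m ⟩
  m ^ n     <⟨ m<m*n (m ^ n) m 1<m ⟩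
  m ^ n * m ≡⟨ *-comm (m ^ n) m ⟩
  m ^ suc n ∎
  where
  open ≤-Reasoning
  instance
    m^n≢0′ : NonZero (m ^ n)
    m^n≢0′ = m^n≢0 m n {{>-nonZero (<-trans (s≤s z≤n) 1<m)}}

≤-<-cross : ∀ a b c d e f .{{_ : NonZero b}} → a * d ≤ c * b → c * f < e * d → a * f < e * b
≤-<-cross a b c d e f ad≤cb cf<ed = *-cancelʳ-< d (a * f) (e * b) (begin-strict
  a * f * d ≡⟨ xy∙z≈xz∙y a f d ⟩
  a * d * f ≤⟨ *-monoˡ-≤ f ad≤cb ⟩
  c * b * f ≡⟨ xy∙z≈xz∙y c b f ⟩
  c * f * b <⟨ *-monoˡ-< b cf<ed ⟩
  e * d * b ≡⟨ xy∙z≈xz∙y e d b ⟩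
  e * b * d ∎)
  where open ≤-Reasoning

floor-transfer : ∀ {A B i} N X Y .{{_ : NonZero B}} →
  A * B < N * (X * Y) → N * (X * Y) < suc A * B → i * Y ≤ A → A < suc i * Y →
  N * X / B ≡ i
floor-transfer {A} {B} {i} N X Y AB<NXY NXY<[1+A]B iY≤A A<[1+i]Y =
  i*n≤m<[1+i]*n⇒m/n≡i (<⇒≤ iB<NX) NX<[1+i]B
  where
  open ≤-Reasoning
  iB<NX : i * B < N * X
  iB<NX = *-cancelʳ-< Y (i * B) (N * X) (begin-strict
    i * B * Y   ≡⟨ xy∙z≈xz∙y i B Y ⟩
    i * Y * B   ≤⟨ *-monoˡ-≤ B iY≤A ⟩
    A * B       <⟨ AB<NXY ⟩
    N * (X * Y) ≡⟨ *-assoc N X Y ⟨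
    N * X * Y   ∎)
  NX<[1+i]B : N * X < suc i * B
  NX<[1+i]B = *-cancelʳ-< Y (N * X) (suc i * B) (begin-strict
    N * X * Y       ≡⟨ *-assoc N X Y ⟩
    N * (X * Y)     <⟨ NXY<[1+A]B ⟩
    suc A * B       ≤⟨ *-monoˡ-≤ B A<[1+i]Y ⟩
    suc i * Y * B   ≡⟨ xy∙z≈xz∙y (suc i) Y B ⟩
    suc i * B * Y   ∎)

suc[pred[m]+pred[n]]≡m+n∸1 : ∀ m n .{{_ : NonZero m}} .{{_ : NonZero n}} → suc (pred m + pred n) ≡ m + n ∸ 1
suc[pred[m]+pred[n]]≡m+n∸1 (suc m) (suc n) = sym (+-suc m n)

-- i/P < (j+1)/Q: the interval [i/P, (i+1)/P) starts before [j/Q, (j+1)/Q) ends.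
StartsBefore : ℕ → ℕ → ℕ → ℕ → Set
StartsBefore P Q i j = i * Q < suc j * P

-- The two intervals overlap, i.e. (i, j) = (⌊tP⌋, ⌊tQ⌋) for some t ≥ 0.
Overlap : ℕ → ℕ → Vertex → Set
Overlap P Q (i , j) = StartsBefore P Q i j × StartsBefore Q P j i

Stair : ℕ → ℕ → Vertex → Set
Stair P Q v = InV P Q v × Overlap P Q v

level : Vertex → ℕ
level (i , j) = i + j

stair-swap : ∀ {P Q i j} → Stair P Q (i , j) → Stair Q P (j , i)
stair-swap (ij∈V , ij∈O) = swap ij∈V , swap ij∈O

stair-step-right : ∀ {P Q i j} → Stair P Q (i , j) → StartsBefore P Q (suc i) j → Stair P Q (suc i , j)
stair-step-right {P} {Q} {i} {j} ((_ , j<Q) , _ , jP<[1+i]Q) [1+i]Q<[1+j]P =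
  (i+1<P , j<Q) , [1+i]Q<[1+j]P , <-≤-trans jP<[1+i]Q (*-monoˡ-≤ Q (n≤1+n (suc i)))
  where
  i+1<P : suc i < P
  i+1<P = *-cancelʳ-< Q (suc i) P
    (<-≤-trans [1+i]Q<[1+j]P (≤-trans (*-monoˡ-≤ P j<Q) (≤-reflexive (*-comm Q P))))

stair-step-up : ∀ {P Q i j} → Stair P Q (i , j) → StartsBefore Q P (suc j) i → Stair P Q (i , suc j)
stair-step-up s [1+j]P<[1+i]Q = stair-swap (stair-step-right (stair-swap s) [1+j]P<[1+i]Q)

module Staircase (P Q : ℕ) .{{_ : NonZero P}} .{{_ : NonZero Q}} where

  fraction⇒stair : ∀ {m n} .{{_ : NonZero n}} → m < n → Stair P Q (m * P / n , m * Q / n)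
  fraction⇒stair {m} {n} m<n = (floor<P P , floor<P Q) , starts-before P Q , starts-before Q P
    where
    floor<P : ∀ X .{{_ : NonZero X}} → m * X / n < X
    floor<P X = m<n*o⇒m/o<n {n = X} (subst (m * X <_) (*-comm n X) (*-monoˡ-< X m<n))

    starts-before : ∀ X Y .{{_ : NonZero X}} → StartsBefore X Y (m * X / n) (m * Y / n)
    starts-before X Y = ≤-<-cross (m * X / n) X m n (suc (m * Y / n)) Y
      (m/n*n≤m (m * X) n) (m<[1+m/n]*n (m * Y) n)

  stair-origin : Stair P Q (0 , 0)
  stair-origin = fraction⇒stair {0} {1} (s≤s z≤n)

  -- N/B is taken in [A/(PQ), (A+1)/(PQ)), where A/(PQ) is the left end of the intersection
  -- of the two intervals; B > PQ makes room for it.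
  stair⇒fraction : ∀ {i j} B .{{_ : NonZero B}} → P * Q < B → Stair P Q (i , j) →
    ∃[ N ] N < B × i ≡ N * P / B × j ≡ N * Q / B
  stair⇒fraction {i} {j} B PQ<B ((i<P , j<Q) , iQ<[1+j]P , jP<[1+i]Q) =
    N , N<B ,
    sym (floor-transfer N P Q AB<NPQ NPQ<[1+A]B (m≤m⊔n (i * Q) (j * P)) A<[1+i]Q) ,
    sym (floor-transfer N Q P (subst (λ D → A * B < N * D) (*-comm P Q) AB<NPQ)
                             (subst (λ D → N * D < suc A * B) (*-comm P Q) NPQ<[1+A]B)
                             (m≤n⊔m (i * Q) (j * P)) A<[1+j]P)
    where
    open ≤-Reasoning
    instance
      P*Q≢0 : NonZero (P * Q)
      P*Q≢0 = m*n≢0 P Q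
    A = i * Q ⊔ j * P
    A<[1+i]Q : A < suc i * Q
    A<[1+i]Q = ⊔-lub (m<n+m (i * Q) (>-nonZero⁻¹ Q)) jP<[1+i]Q
    A<[1+j]P : A < suc j * P
    A<[1+j]P = ⊔-lub iQ<[1+j]P (m<n+m (j * P) (>-nonZero⁻¹ P))
    N = suc (A * B / (P * Q))
    AB<NPQ : A * B < N * (P * Q)
    AB<NPQ = m<[1+m/n]*n (A * B) (P * Q)
    NPQ<[1+A]B : N * (P * Q) < suc A * B
    NPQ<[1+A]B = begin-strict
      P * Q + A * B / (P * Q) * (P * Q) ≤⟨ +-monoʳ-≤ (P * Q) (m/n*n≤m (A * B) (P * Q)) ⟩
      P * Q + A * B                     <⟨ +-monoˡ-< (A * B) PQ<B ⟩
      B + A * B                         ∎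
    N<B : N < B
    N<B = *-cancelʳ-< (P * Q) N B (begin-strict
      N * (P * Q) <⟨ NPQ<[1+A]B ⟩
      suc A * B   ≤⟨ *-monoˡ-≤ B (≤-trans A<[1+i]Q (*-monoˡ-≤ Q i<P)) ⟩
      P * Q * B   ≡⟨ *-comm (P * Q) B ⟩
      B * (P * Q) ∎)

  floorPt⇒stair : ∀ {v} → FloorPt P Q v → Stair P Q v
  floorPt⇒stair (_ , _ , m<k+1 , refl , refl) = fraction⇒stair m<k+1

  stair⇒floorPt : ∀ {v} → Stair P Q v → FloorPt P Q v
  stair⇒floorPt s with stair⇒fraction (suc (P * Q)) ≤-refl s
  ... | N , N<1+PQ , i≡ , j≡ = P * Q , N , N<1+PQ , i≡ , j≡

  corner : Vertex
  corner = pred P , pred Q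

  overlap-monotone : ∀ {i j i′ j′} → Overlap P Q (i , j) → Overlap P Q (i′ , j′) → i < i′ → j ≤ j′
  overlap-monotone {i} {j} {i′} {j′} (_ , jP<[1+i]Q) (i′Q<[1+j′]P , _) i<i′ =
    ≮⇒≥ λ j′<j → <-irrefl refl (begin-strict
      suc i * Q  ≤⟨ *-monoˡ-≤ Q i<i′ ⟩
      i′ * Q     <⟨ i′Q<[1+j′]P ⟩
      suc j′ * P ≤⟨ *-monoˡ-≤ P j′<j ⟩
      j * P      <⟨ jP<[1+i]Q ⟩
      suc i * Q  ∎)
    where open ≤-Reasoning

  overlap-unique : ∀ {u v} → Overlap P Q u → Overlap P Q v → level u ≡ level v → u ≡ v
  overlap-unique {i , j} {i′ , j′} o o′ i+j≡i′+j′ with <-cmp i i′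
  ... | tri< i<i′ _ _ = ⊥-elim (<-irrefl i+j≡i′+j′ (+-mono-<-≤ i<i′ (overlap-monotone o o′ i<i′)))
  ... | tri≈ _ i≡i′ _ = cong₂ _,_ i≡i′ (+-cancelˡ-≡ i j j′ (trans i+j≡i′+j′ (cong (_+ j′) (sym i≡i′))))
  ... | tri> _ _ i′<i = ⊥-elim (<-irrefl (sym i+j≡i′+j′) (+-mono-<-≤ i′<i (overlap-monotone o′ o i′<i)))

  next : Vertex → Vertex
  next (i , j) with suc i * Q <? suc j * P
  ... | yes _ = suc i , j
  ... | no  _ = i , suc j

  level-next : ∀ w → level (next w) ≡ suc (level w)
  level-next (i , j) with suc i * Q <? suc j * P
  ... | yes _ = refl
  ... | no  _ = +-suc i j

  next-cases : ∀ (A : Vertex → Set) i j → A (next (i , j)) → A (suc i , j) ⊎ A (i , suc j)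
  next-cases A i j with suc i * Q <? suc j * P
  ... | yes _ = inj₁
  ... | no  _ = inj₂

  cell : ℕ → Vertex
  cell zero    = 0 , 0
  cell (suc s) = next (cell s)

  level-cell : ∀ s → level (cell s) ≡ s
  level-cell zero    = refl
  level-cell (suc s) = trans (level-next (cell s)) (cong suc (level-cell s))

  stairs : List Vertex
  stairs = applyUpTo cell (P + Q ∸ 1)

  level<P+Q∸1 : ∀ {v} → InV P Q v → level v < P + Q ∸ 1
  level<P+Q∸1 (i<P , j<Q) = ≤-trans (s≤s (+-mono-≤ (<⇒≤pred i<P) (<⇒≤pred j<Q)))
                                    (≤-reflexive (suc[pred[m]+pred[n]]≡m+n∸1 P Q))

  stairs-unique : Unique stairs
  stairs-unique = applyUpTo⁺₁ cell (P + Q ∸ 1) λ {s} {t} s<t _ cell-s≡cell-t →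
    <⇒≢ s<t (trans (sym (level-cell s)) (trans (cong level cell-s≡cell-t) (level-cell t)))

  module Enumeration (P⊥Q : Coprime P Q) where

    -- The segment from (0,0) to (P,Q) meets no lattice point strictly in between.
    coprime-cross-eq⇒corner : ∀ {i j} → i < P → suc i * Q ≡ suc j * P → (i , j) ≡ corner
    coprime-cross-eq⇒corner {i} {j} i<P [1+i]Q≡[1+j]P =
      cong₂ _,_ (cong pred [1+i]≡P) (cong pred [1+j]≡Q)
      where
      P∣[1+i] : P ∣ suc i
      P∣[1+i] = coprime-divisor P⊥Q (divides (suc j) (trans (*-comm Q (suc i)) [1+i]Q≡[1+j]P))
      [1+i]≡P : suc i ≡ P
      [1+i]≡P = ≤-antisym i<P (∣⇒≤ P∣[1+i])
      [1+j]≡Q : suc j ≡ Q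
      [1+j]≡Q = *-cancelʳ-≡ (suc j) Q P (begin
        suc j * P ≡⟨ [1+i]Q≡[1+j]P ⟨
        suc i * Q ≡⟨ cong (_* Q) [1+i]≡P ⟩
        P * Q     ≡⟨ *-comm P Q ⟩
        Q * P     ∎)
        where open ≡-Reasoning

    next-stair : ∀ {w} → Stair P Q w → w ≢ corner → Stair P Q (next w)
    next-stair {i , j} s w≢corner with suc i * Q <? suc j * P
    ... | yes [1+i]Q<[1+j]P = stair-step-right s [1+i]Q<[1+j]P
    ... | no  [1+i]Q≮[1+j]P with m≤n⇒m<n∨m≡n (≮⇒≥ [1+i]Q≮[1+j]P)
    ...   | inj₁ [1+j]P<[1+i]Q = stair-step-up s [1+j]P<[1+i]Q
    ...   | inj₂ [1+j]P≡[1+i]Q =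
      ⊥-elim (w≢corner (coprime-cross-eq⇒corner (proj₁ (proj₁ s)) (sym [1+j]P≡[1+i]Q)))

    cell-stair : ∀ s → s < P + Q ∸ 1 → Stair P Q (cell s)
    cell-stair zero    _  = stair-origin
    cell-stair (suc s) s+1<size = next-stair (cell-stair s (<-trans (n<1+n s) s+1<size)) cell≢corner
      where
      cell≢corner : cell s ≢ corner
      cell≢corner cell≡corner = <-irrefl (begin
        suc s                 ≡⟨ cong suc (level-cell s) ⟨
        suc (level (cell s))  ≡⟨ cong (suc ∘ level) cell≡corner ⟩
        suc (level corner)    ≡⟨ suc[pred[m]+pred[n]]≡m+n∸1 P Q ⟩
        P + Q ∸ 1             ∎) s+1<size
        where open ≡-Reasoning

    stair⇒≡cell : ∀ {v} → Stair P Q v → v ≡ cell (level v)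
    stair⇒≡cell {v} (v∈V , v∈O) = overlap-unique v∈O
      (proj₂ (cell-stair (level v) (level<P+Q∸1 v∈V))) (sym (level-cell (level v)))

    ∈-stairs⁺ : ∀ {v} → Stair P Q v → v ∈ stairs
    ∈-stairs⁺ s = subst (_∈ stairs) (sym (stair⇒≡cell s)) (∈-applyUpTo⁺ cell (level<P+Q∸1 (proj₁ s)))

    ∈-stairs⁻ : ∀ {v} → v ∈ stairs → Stair P Q v
    ∈-stairs⁻ v∈stairs with ∈-applyUpTo⁻ cell v∈stairs
    ... | s , s<size , refl = cell-stair s s<size

module Digraph (b P Q : ℕ) .{{_ : NonZero b}} .{{_ : NonZero P}} .{{_ : NonZero Q}} (1<b : 1 < b) where

  open Staircase P Q using (fraction⇒stair; stair-origin; stair⇒fraction)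

  -- An edge with label r appends the digit r in front of the base-b expansion of t.
  append-digit : ∀ B N r X .{{_ : NonZero B}} .{{_ : NonZero (b * B)}} →
                 (N * X / B + r * X) / b ≡ (N + r * B) * X / (b * B)
  append-digit B N r X = trans ([m/n+o]/p≡[m+o*n]/[p*n] (N * X) B (r * X) b)
                               (cong (_/ (b * B)) (distrib N r X B))
    where
    distrib : ∀ N r X B → N * X + r * X * B ≡ (N + r * B) * X
    distrib = solve-∀

  append-digit-< : ∀ {B N r} → N < B → r < b → N + r * B < b * B
  append-digit-< {B} {N} {r} N<B r<b = begin-strict
    N + r * B <⟨ +-monoˡ-< (r * B) N<B ⟩
    B + r * B ≤⟨ *-monoˡ-≤ B r<b ⟩
    b * B     ∎
    where open ≤-Reasoning

  edge-stair : ∀ {u v} → Stair P Q u → Edge b P Q u v → Stair P Q v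
  edge-stair {i , j} s (_ , r , r<b , refl , refl)
    with stair⇒fraction (suc (P * Q)) ≤-refl s
  ... | N , N<B , refl , refl =
    subst₂ (λ k l → Stair P Q (k , l))
      (sym (append-digit B N r P)) (sym (append-digit B N r Q))
      (fraction⇒stair (append-digit-< N<B r<b))
    where
    B = suc (P * Q)
    instance
      bB≢0 : NonZero (b * B)
      bB≢0 = m*n≢0 b B

  reach-stair : ∀ {u v} → Stair P Q u → Reach b P Q u v → Stair P Q v
  reach-stair s ε        = s
  reach-stair s (e ◅ es) = reach-stair (edge-stair s e) es

  digit-edge : ∀ {B N r} .{{_ : NonZero B}} .{{_ : NonZero (b * B)}} → N < B → r < b →
    Edge b P Q (N * P / B , N * Q / B) ((N + r * B) * P / (b * B) , (N + r * B) * Q / (b * B))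
  digit-edge {B} {N} {r} N<B r<b = proj₁ (fraction⇒stair N<B) , r , r<b ,
    sym (append-digit B N r P) , sym (append-digit B N r Q)

  reach-fraction : ∀ n N .{{_ : NonZero (b ^ n)}} → N < b ^ n →
                   Reach b P Q (0 , 0) (N * P / b ^ n , N * Q / b ^ n)
  reach-fraction zero    zero    _          = ε
  reach-fraction zero    (suc N) (s≤s ())
  reach-fraction (suc n) N       N<bB = reach-fraction n (N % B) (m%n<n N B) ◅◅ (last-edge ◅ ε)
    where
    B = b ^ n
    instance
      B≢0 : NonZero B
      B≢0 = m^n≢0 b n
      bB≢0 : NonZero (b * B)
      bB≢0 = m^n≢0 b (suc n)
    last-edge : Edge b P Q (N % B * P / B , N % B * Q / B) (N * P / (b * B) , N * Q / (b * B))
    last-edge = subst (λ M → Edge b P Q (N % B * P / B , N % B * Q / B) (M * P / (b * B) , M * Q / (b * B)))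
      (sym (m≡m%n+[m/n]*n N B)) (digit-edge (m%n<n N B) (m<n*o⇒m/o<n {n = b} N<bB))

  zero-digit-edge : ∀ {i j} → InV P Q (i , j) → Edge b P Q (i , j) (i / b , j / b)
  zero-digit-edge {i} {j} ij∈V = ij∈V , 0 , >-nonZero⁻¹ b ,
    cong (_/ b) (sym (+-identityʳ i)) , cong (_/ b) (sym (+-identityʳ j))

  reach-/b^n : ∀ n .{{_ : NonZero (b ^ n)}} {i j} → InV P Q (i , j) →
               Reach b P Q (i , j) (i / b ^ n , j / b ^ n)
  reach-/b^n zero    {i} {j} _ = subst₂ (λ k l → Reach b P Q (i , j) (k , l)) (sym (n/1≡n i)) (sym (n/1≡n j)) ε
  reach-/b^n (suc n) {i} {j} ij∈V@(i<P , j<Q) =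
    zero-digit-edge ij∈V ◅
    subst₂ (λ k l → Reach b P Q (i / b , j / b) (k , l))
      (m/n/o≡m/[n*o] i b (b ^ n)) (m/n/o≡m/[n*o] j b (b ^ n))
      (reach-/b^n n (≤-<-trans (m/n≤m i b) i<P , ≤-<-trans (m/n≤m j b) j<Q))
    where
    instance
      b^n≢0 : NonZero (b ^ n)
      b^n≢0 = m^n≢0 b n

  reach-origin : ∀ {i j} → InV P Q (i , j) → Reach b P Q (i , j) (0 , 0)
  reach-origin {i} {j} ij∈V = subst₂ (λ k l → Reach b P Q (i , j) (k , l))
    (m<n⇒m/n≡0 (≤-<-trans (m≤m+n i j) (n<m^n b (i + j) 1<b)))
    (m<n⇒m/n≡0 (≤-<-trans (m≤n+m j i) (n<m^n b (i + j) 1<b)))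
    (reach-/b^n (i + j) ij∈V)
    where
    instance
      b^n≢0 : NonZero (b ^ (i + j))
      b^n≢0 = m^n≢0 b (i + j)

  inC⇒stair : ∀ {v} → InC b P Q v → Stair P Q v
  inC⇒stair (_ , 0↝v , _) = reach-stair (stair-origin) 0↝v

  stair⇒inC : ∀ {v} → Stair P Q v → InC b P Q v
  stair⇒inC {i , j} s@(ij∈V , _)
    with stair⇒fraction (b ^ (P * Q)) {{m^n≢0 b (P * Q)}} (n<m^n b (P * Q) 1<b) s
  ... | N , N<B , refl , refl =
    ij∈V , reach-fraction (P * Q) N {{m^n≢0 b (P * Q)}} N<B , reach-origin ij∈V

lemma2 : (b P Q : ℕ) → .{{_ : NonZero b}} → 2 ≤ b → 1 ≤ P → 1 ≤ Q →
    Coprime P Q → Coprime P b → Coprime Q b →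
    HasCard (InC b P Q) (P + Q ∸ 1)
    × (∀ v → (InC b P Q v → FloorPt P Q v) × (FloorPt P Q v → InC b P Q v))
    × (∀ i j → InC b P Q (i , j) → ¬ ((i , j) ≡ (P ∸ 1 , Q ∸ 1)) →
         InC b P Q (suc i , j) ⊎ InC b P Q (i , suc j))
lemma2 b P Q 1<b 0<P 0<Q P⊥Q _ _ =
  (stairs , stairs-unique , length-applyUpTo cell (P + Q ∸ 1) ,
   λ _ → stair⇒inC ∘ ∈-stairs⁻ , ∈-stairs⁺ ∘ inC⇒stair) ,
  (λ _ → stair⇒floorPt ∘ inC⇒stair , stair⇒inC ∘ floorPt⇒stair) ,
  λ i j ij∈C ij≢corner →
    next-cases (InC b P Q) i j (stair⇒inC (next-stair (inC⇒stair ij∈C) ij≢corner))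
  where
  instance
    P≢0 : NonZero P
    P≢0 = >-nonZero 0<P
    Q≢0 : NonZero Q
    Q≢0 = >-nonZero 0<Q
  open Staircase P Q
  open Enumeration P⊥Q
  open Digraph b P Q 1<b
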